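{- Let $N = \{a,b,c,d,e,f,g,h\}$ be a set of eight distinct elements and let $G = \{\{a,b\}, \{a,e,d\}, \{b,f,c\}, \{c,g,d\}, \{e,h,f\}\}$. In the game in which Black and White alternately claim previously unclaimed elements of $N$, Black moving first, until all of $N$ is claimed, White has a strategy guaranteeing that every set in $G$ contains at least one element claimed by White.
   Context: This is the "Square/Line Configuration". The elements of $N$ are called markers, and the sets in $G$ are the traces on the markers of groups (possible winning lines) of a $k$-in-a-Row game. -}

module Defs where

open import Data.Nat using (ℕ; zero; suc)
open import Data.Fin using (Fin; _≟_)
open import Data.List using (List; []; _∷_)
open import Data.List.Relation.Unary.All using (All)
open import Data.List.Relation.Unary.Any using (Any)
open import Data.Product using (Σ; _×_)
open import Relation.Binary.PropositionalEquality using (_≡_)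
open import Relation.Nullary using (yes; no)

Marker : Set
Marker = Fin 8

a b c d e f g h : Marker
a = Data.Fin.zero
b = Data.Fin.suc Data.Fin.zero
c = Data.Fin.suc (Data.Fin.suc Data.Fin.zero)
d = Data.Fin.suc (Data.Fin.suc (Data.Fin.suc Data.Fin.zero))
e = Data.Fin.suc (Data.Fin.suc (Data.Fin.suc (Data.Fin.suc Data.Fin.zero)))
f = Data.Fin.suc (Data.Fin.suc (Data.Fin.suc (Data.Fin.suc (Data.Fin.suc Data.Fin.zero))))
g = Data.Fin.suc (Data.Fin.suc (Data.Fin.suc (Data.Fin.suc (Data.Fin.suc (Data.Fin.suc Data.Fin.zero)))))
h = Data.Fin.suc (Data.Fin.suc (Data.Fin.suc (Data.Fin.suc (Data.Fin.suc (Data.Fin.suc (Data.Fin.suc Data.Fin.zero))))))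

G : List (List Marker)
G = (a ∷ b ∷ []) ∷ (a ∷ e ∷ d ∷ []) ∷ (b ∷ f ∷ c ∷ []) ∷ (c ∷ g ∷ d ∷ [])
  ∷ (e ∷ h ∷ f ∷ []) ∷ []

data Cell : Set where
  unclaimed black white : Cell

Board : Set
Board = Marker → Cell

emptyBoard : Board
emptyBoard _ = unclaimed

claim : Board → Marker → Cell → Board
claim B x col y with y ≟ x
... | yes _ = col
... | no  _ = B y

WhiteGoal : Board → Set
WhiteGoal B = All (λ S → Any (λ x → B x ≡ white) S) G

-- "White can force WhiteGoal" from a position where k markers remain
-- unclaimed (k is exactly the number of remaining moves; play ends when
-- all markers are claimed).  A witness is precisely a White strategy:
-- at each White turn it picks an unclaimed marker, and it must work
-- against every legal Black move.
mutual
  BlackToMove : ℕ → Board → Set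
  BlackToMove zero    B = WhiteGoal B
  BlackToMove (suc k) B =
    (x : Marker) → B x ≡ unclaimed → WhiteToMove k (claim B x black)

  WhiteToMove : ℕ → Board → Set
  WhiteToMove zero    B = WhiteGoal B
  WhiteToMove (suc k) B =
    Σ Marker (λ y → (B y ≡ unclaimed) × BlackToMove k (claim B y white))

WhiteHasWinningStrategy : Set
WhiteHasWinningStrategy = BlackToMove 8 emptyBoard

-- After Black's opening move White answers so that the winning sets not yet blocked
-- contain three disjoint pairs covering exactly the six remaining markers (the answer
-- is b to a, and a to anything else).  From then on White plays the pairing strategy:
-- whenever Black claims a marker, White claims its partner, so each of those winning
-- sets ends up with a White marker.
module Submission where

open import Defs
open import Data.Nat using (ℕ; zero; suc; _+_)
open import Data.Nat.Properties using (+-suc; m+n≡0⇒n≡0; 1+n≢0)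
import Data.Nat.Properties as ℕ
open import Data.Fin using (Fin; zero; suc; _≟_)
open import Data.Fin.Properties using (all?; suc-injective)
open import Data.Vec using (Vec; []; _∷_; lookup)
open import Data.List using (List; []; _∷_)
open import Data.List.Relation.Unary.All as All using (All)
open import Data.List.Relation.Unary.Any as Any using (Any)
open import Data.List.Membership.Propositional using (_∈_; find; lose)
open import Data.List.Membership.DecPropositional (_≟_ {8}) using (_∈?_)
open import Data.Product using (_×_; _,_; proj₁; proj₂)
open import Data.Sum using (_⊎_; inj₁; inj₂)
open import Data.Empty using (⊥-elim)
open import Function using (_∘_)
open import Relation.Binary.Definitions using (DecidableEquality)
open import Relation.Binary.PropositionalEquality
  using (_≡_; _≢_; refl; sym; trans; cong; cong₂; module ≡-Reasoning)
open import Relation.Nullary using (Dec; yes; no; ¬?)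
open import Relation.Nullary.Decidable using (_×-dec_; _⊎-dec_; _→-dec_; from-yes)

_≟ᶜ_ : DecidableEquality Cell
unclaimed ≟ᶜ unclaimed = yes refl
unclaimed ≟ᶜ black     = no λ ()
unclaimed ≟ᶜ white     = no λ ()
black     ≟ᶜ unclaimed = no λ ()
black     ≟ᶜ black     = yes refl
black     ≟ᶜ white     = no λ ()
white     ≟ᶜ unclaimed = no λ ()
white     ≟ᶜ black     = no λ ()
white     ≟ᶜ white     = yes refl

claim-≡ : ∀ B x col → claim B x col x ≡ col
claim-≡ B x col with x ≟ x
... | yes _  = refl
... | no x≢x = ⊥-elim (x≢x refl)

claim-≢ : ∀ B x col {y} → y ≢ x → claim B x col y ≡ B y
claim-≢ B x col {y} y≢x with y ≟ x
... | yes y≡x = ⊥-elim (y≢x y≡x)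
... | no _    = refl

claim-unclaimed : ∀ B x col {y} → col ≢ unclaimed →
                  claim B x col y ≡ unclaimed → y ≢ x × B y ≡ unclaimed
claim-unclaimed B x col {y} col≢unclaimed y-free with y ≟ x
... | yes _   = ⊥-elim (col≢unclaimed y-free)
... | no y≢x = y≢x , y-free

claim-keeps-white : ∀ B x col {y} → B x ≡ unclaimed → B y ≡ white → claim B x col y ≡ white
claim-keeps-white B x col {y} x-free y-white = trans (claim-≢ B x col y≢x) y-white
  where
  y≢x : y ≢ x
  y≢x refl with trans (sym y-white) x-free
  ... | ()

unclaimedWeight : Cell → ℕ
unclaimedWeight unclaimed = 1
unclaimedWeight _         = 0

unclaimedCount : ∀ {n} → (Fin n → Cell) → ℕ
unclaimedCount {zero}  B = 0
unclaimedCount {suc n} B = unclaimedWeight (B zero) + unclaimedCount (B ∘ suc)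

unclaimedWeight-claimed : ∀ {c} → c ≢ unclaimed → unclaimedWeight c ≡ 0
unclaimedWeight-claimed {unclaimed} c≢unclaimed = ⊥-elim (c≢unclaimed refl)
unclaimedWeight-claimed {black}     _           = refl
unclaimedWeight-claimed {white}     _           = refl

unclaimedCount-cong : ∀ {n} {B B′ : Fin n → Cell} →
                      (∀ y → B y ≡ B′ y) → unclaimedCount B ≡ unclaimedCount B′
unclaimedCount-cong {zero}  B≗B′ = refl
unclaimedCount-cong {suc n} B≗B′ =
  cong₂ _+_ (cong unclaimedWeight (B≗B′ zero)) (unclaimedCount-cong (B≗B′ ∘ suc))

unclaimedCount-update : ∀ {n} (B B′ : Fin n → Cell) x →
                        (∀ y → y ≢ x → B′ y ≡ B y) → B x ≡ unclaimed → B′ x ≢ unclaimed →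
                        unclaimedCount B ≡ suc (unclaimedCount B′)
unclaimedCount-update B B′ zero agree x-free x-taken = begin
  unclaimedWeight (B zero) + unclaimedCount (B ∘ suc)
    ≡⟨ cong₂ _+_ (cong unclaimedWeight x-free)
                 (unclaimedCount-cong (λ y → sym (agree (suc y) λ ()))) ⟩
  suc (unclaimedCount (B′ ∘ suc))
    ≡⟨ cong (λ w → suc (w + unclaimedCount (B′ ∘ suc))) (sym (unclaimedWeight-claimed x-taken)) ⟩
  suc (unclaimedWeight (B′ zero) + unclaimedCount (B′ ∘ suc)) ∎
  where open ≡-Reasoning
unclaimedCount-update B B′ (suc x) agree x-free x-taken = begin
  unclaimedWeight (B zero) + unclaimedCount (B ∘ suc)
    ≡⟨ cong₂ _+_ (cong unclaimedWeight (sym (agree zero λ ())))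
                 (unclaimedCount-update (B ∘ suc) (B′ ∘ suc) x
                   (λ y y≢x → agree (suc y) (y≢x ∘ suc-injective)) x-free x-taken) ⟩
  unclaimedWeight (B′ zero) + suc (unclaimedCount (B′ ∘ suc))
    ≡⟨ +-suc (unclaimedWeight (B′ zero)) _ ⟩
  suc (unclaimedWeight (B′ zero) + unclaimedCount (B′ ∘ suc)) ∎
  where open ≡-Reasoning

unclaimedCount-zero : ∀ {n} (B : Fin n → Cell) y → unclaimedCount B ≡ 0 → B y ≢ unclaimed
unclaimedCount-zero B zero    count≡0 y-free =
  1+n≢0 (trans (cong (λ c → unclaimedWeight c + unclaimedCount (B ∘ suc)) (sym y-free)) count≡0)
unclaimedCount-zero B (suc y) count≡0 =
  unclaimedCount-zero (B ∘ suc) y (m+n≡0⇒n≡0 (unclaimedWeight (B zero)) count≡0)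

unclaimedCount-claim : ∀ {k} B x col → unclaimedCount B ≡ suc k →
                       B x ≡ unclaimed → col ≢ unclaimed → unclaimedCount (claim B x col) ≡ k
unclaimedCount-claim B x col count x-free col≢unclaimed = ℕ.suc-injective (trans (sym
  (unclaimedCount-update B (claim B x col) x (λ y → claim-≢ B x col) x-free
    (λ x-free′ → col≢unclaimed (trans (sym (claim-≡ B x col)) x-free′)))) count)

PairsUnclaimed : (Marker → Marker) → Board → Set
PairsUnclaimed π B = ∀ y → B y ≡ unclaimed → B (π y) ≡ unclaimed × π y ≢ y × π (π y) ≡ y

Guarded : (Marker → Marker) → Board → List Marker → Set
Guarded π B S = Any (λ y → B y ≡ white) S ⊎ Any (λ y → B y ≡ unclaimed × π y ∈ S) S

playRound : Board → Marker → Marker → Board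
playRound B x z = claim (claim B x black) z white

playRound-unclaimed : ∀ B x z {y} → playRound B x z y ≡ unclaimed →
                      y ≢ x × y ≢ z × B y ≡ unclaimed
playRound-unclaimed B x z y-free′ =
  let y≢z , y-free₁ = claim-unclaimed (claim B x black) z white (λ ()) y-free′
      y≢x , y-free  = claim-unclaimed B x black (λ ()) y-free₁
  in y≢x , y≢z , y-free

playRound-≢ : ∀ B x z {y} → y ≢ x → y ≢ z → playRound B x z y ≡ B y
playRound-≢ B x z y≢x y≢z = trans (claim-≢ (claim B x black) z white y≢z) (claim-≢ B x black y≢x)

playRound-keeps-white : ∀ B x z {y} → B x ≡ unclaimed → B z ≡ unclaimed → z ≢ x →
                        B y ≡ white → playRound B x z y ≡ white
playRound-keeps-white B x z {y} x-free z-free z≢x y-white =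
  claim-keeps-white (claim B x black) z white {y} (trans (claim-≢ B x black z≢x) z-free)
    (claim-keeps-white B x black x-free y-white)

PairsUnclaimed-playRound : ∀ {π B x} → PairsUnclaimed π B → B x ≡ unclaimed →
                           PairsUnclaimed π (playRound B x (π x))
PairsUnclaimed-playRound {π} {B} {x} paired x-free y y-free′ =
  let y≢x , y≢πx , y-free       = playRound-unclaimed B x (π x) y-free′
      πy-free , πy≢y , ππy≡y     = paired y y-free
      _ , _ , ππx≡x              = paired x x-free
      πy≢x : π y ≢ x
      πy≢x πy≡x = y≢πx (trans (sym ππy≡y) (cong π πy≡x))
      πy≢πx : π y ≢ π x
      πy≢πx πy≡πx = y≢x (trans (sym ππy≡y) (trans (cong π πy≡πx) ππx≡x))
  in trans (playRound-≢ B x (π x) πy≢x πy≢πx) πy-free , πy≢y , ππy≡y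

Guarded-playRound : ∀ {π B x} → PairsUnclaimed π B → B x ≡ unclaimed →
                    ∀ {S} → Guarded π B S → Guarded π (playRound B x (π x)) S
Guarded-playRound {π} {B} {x} paired x-free (inj₁ whites) =
  let πx-free , πx≢x , _ = paired x x-free
  in inj₁ (Any.map (playRound-keeps-white B x (π x) x-free πx-free πx≢x) whites)
Guarded-playRound {π} {B} {x} paired x-free (inj₂ open-pairs)
  with find open-pairs
... | y , y∈S , y-free , πy∈S with y ≟ x
...   | yes refl = inj₁ (lose πy∈S (claim-≡ (claim B y black) (π y) white))
...   | no y≢x with y ≟ π x
...     | yes refl = inj₁ (lose y∈S (claim-≡ (claim B x black) (π x) white))
...     | no y≢πx  = inj₂ (lose y∈S (trans (playRound-≢ B x (π x) y≢x y≢πx) y-free , πy∈S))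

pairingStrategy : ∀ π k B → unclaimedCount B ≡ k → PairsUnclaimed π B → All (Guarded π B) G →
                  BlackToMove k B
pairingStrategy π zero B none _ guarded = All.map blocked guarded
  where
  blocked : ∀ {S} → Guarded π B S → Any (λ y → B y ≡ white) S
  blocked (inj₁ whites)     = whites
  blocked (inj₂ open-pairs) =
    ⊥-elim (unclaimedCount-zero B _ none (proj₁ (proj₂ (Any.satisfied open-pairs))))
pairingStrategy π (suc zero) B count paired _ x x-free =
  let πx-free , πx≢x , _ = paired x x-free
  in ⊥-elim (unclaimedCount-zero (claim B x black) (π x)
               (unclaimedCount-claim B x black count x-free (λ ()))
               (trans (claim-≢ B x black πx≢x) πx-free))
pairingStrategy π (suc (suc k)) B count paired guarded x x-free =
  let πx-free , πx≢x , _ = paired x x-free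
      count₁   = unclaimedCount-claim B x black count x-free (λ ())
      πx-free₁ = trans (claim-≢ B x black πx≢x) πx-free
  in π x , πx-free₁ ,
     pairingStrategy π k (playRound B x (π x))
       (unclaimedCount-claim (claim B x black) (π x) white count₁ πx-free₁ (λ ()))
       (PairsUnclaimed-playRound paired x-free)
       (All.map (Guarded-playRound paired x-free) guarded)

partnerIn : List (Marker × Marker) → Marker → Marker
partnerIn []             y = y
partnerIn ((u , v) ∷ ps) y with y ≟ u | y ≟ v
... | yes _ | _     = v
... | no _  | yes _ = u
... | no _  | no _  = partnerIn ps y

-- Row x: White's answer to Black's opening move x, and the pairing White follows afterwards.
opening : Vec (Marker × List (Marker × Marker)) 8
opening = (b , (e , d) ∷ (c , g) ∷ (h , f) ∷ [])
        ∷ (a , (f , c) ∷ (g , d) ∷ (e , h) ∷ [])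
        ∷ (a , (b , f) ∷ (g , d) ∷ (e , h) ∷ [])
        ∷ (a , (b , f) ∷ (c , g) ∷ (e , h) ∷ [])
        ∷ (a , (b , c) ∷ (g , d) ∷ (h , f) ∷ [])
        ∷ (a , (b , c) ∷ (g , d) ∷ (e , h) ∷ [])
        ∷ (a , (b , f) ∷ (c , d) ∷ (e , h) ∷ [])
        ∷ (a , (b , c) ∷ (g , d) ∷ (e , f) ∷ [])
        ∷ []

openingAnswer : Marker → Marker
openingAnswer x = proj₁ (lookup opening x)

openingPartner : Marker → Marker → Marker
openingPartner x = partnerIn (proj₂ (lookup opening x))

afterOpening : Marker → Board
afterOpening x = playRound emptyBoard x (openingAnswer x)

PairingStrategyApplies : Marker → Set
PairingStrategyApplies x =
  openingAnswer x ≢ x × unclaimedCount (afterOpening x) ≡ 6 ×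
  PairsUnclaimed (openingPartner x) (afterOpening x) ×
  All (Guarded (openingPartner x) (afterOpening x)) G

pairsUnclaimed? : ∀ π B → Dec (PairsUnclaimed π B)
pairsUnclaimed? π B = all? λ y →
  B y ≟ᶜ unclaimed →-dec (B (π y) ≟ᶜ unclaimed ×-dec ¬? (π y ≟ y) ×-dec π (π y) ≟ y)

guarded? : ∀ π B S → Dec (Guarded π B S)
guarded? π B S =
  Any.any? (λ y → B y ≟ᶜ white) S ⊎-dec Any.any? (λ y → B y ≟ᶜ unclaimed ×-dec π y ∈? S) S

pairingStrategyApplies : ∀ x → PairingStrategyApplies x
pairingStrategyApplies = from-yes (all? λ x →
  ¬? (openingAnswer x ≟ x) ×-dec unclaimedCount (afterOpening x) ℕ.≟ 6 ×-dec
  pairsUnclaimed? (openingPartner x) (afterOpening x) ×-dec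
  All.all? (guarded? (openingPartner x) (afterOpening x)) G)

mainTheorem3 : WhiteHasWinningStrategy
mainTheorem3 x _ =
  let answer≢x , count , paired , guarded = pairingStrategyApplies x
  in openingAnswer x , claim-≢ emptyBoard x black answer≢x ,
     pairingStrategy (openingPartner x) 6 (afterOpening x) count paired guarded
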